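{- Let $r\ge1$, $k_1,\dots,k_r\in\mathbb{Z}$, $a$ a complex number that is not an integer $\le r-1$, and $n\ge0$. Then $$B_{n,a}^{(k_1,\ldots,k_r)}=\sum_{0\le m_1\le m_2\le\cdots\le m_r\le n}\frac{(-1)^{n+m_r}m_r!\left\{{n\atop m_r}\right\}}{(m_1+a-r+1)^{k_1}(m_2+a-r+2)^{k_2}\cdots(m_r+a)^{k_r}},$$ where $\left\{{n\atop m}\right\}$ denotes the Stirling numbers of the second kind.
   Context: For a positive integer $r$, integers $k_1,\dots,k_r$ and $a$ as stated, the Hurwitz-Lerch multiple zeta function is the formal power series $$\Phi_{(k_1,\ldots,k_r)}(z,a)=\sum_{0\le m_1\le m_2\le\cdots\le m_r}\frac{z^{m_r}}{(m_1+a-r+1)^{k_1}(m_2+a-r+2)^{k_2}\cdots(m_r+a)^{k_r}},$$ and the Hurwitz-Lerch type multi poly-Bernoulli numbers are defined by $\Phi_{(k_1,\ldots,k_r)}(1-e^{ -t},a)=\sum_{n\ge0}B_{n,a}^{(k_1,\ldots,k_r)}\frac{t^n}{n!}$. -}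

module Defs where

open import Level using (Level; _⊔_)
open import Algebra.Bundles using (CommutativeRing)
open import Data.Nat as ℕ using (ℕ; zero; suc; _∸_)
open import Data.Nat.Base using (_!)
open import Data.Integer as ℤ using (ℤ; +_; -[1+_])
open import Data.Fin using (Fin; toℕ)
open import Data.Vec as Vec using (Vec; []; _∷_; _∷ʳ_)
open import Data.List as List using (List; []; _∷_; upTo; concatMap)
open import Relation.Nullary using (¬_)

-- A field of characteristic zero: a commutative ring with a (total)
-- inverse operation that is a genuine inverse on non-zero elements,
-- 0 ≠ 1, and n·1 ≠ 0 for every n ≥ 1.  (The complex numbers are one.)

module _ {c ℓ : Level} (R : CommutativeRing c ℓ) where
  open CommutativeRing R

  ringFromℕ : ℕ → Carrier
  ringFromℕ zero    = 0#
  ringFromℕ (suc n) = 1# + ringFromℕ n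

  ringFromℤ : ℤ → Carrier
  ringFromℤ (+ n)    = ringFromℕ n
  ringFromℤ -[1+ n ] = - ringFromℕ (suc n)

record CharZeroField (c ℓ : Level) : Set (Level.suc (c ⊔ ℓ)) where
  field
    commRing : CommutativeRing c ℓ
    _⁻¹      : CommutativeRing.Carrier commRing → CommutativeRing.Carrier commRing
    inverseʳ : ∀ x → ¬ (CommutativeRing._≈_ commRing x (CommutativeRing.0# commRing))
               → CommutativeRing._≈_ commRing (CommutativeRing._*_ commRing x (x ⁻¹)) (CommutativeRing.1# commRing)
    charZero : ∀ n → ¬ (CommutativeRing._≈_ commRing (ringFromℕ commRing (suc n)) (CommutativeRing.0# commRing))
  open CommutativeRing commRing public

  fromℕ : ℕ → Carrier
  fromℕ = ringFromℕ commRing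

  fromℤ : ℤ → Carrier
  fromℤ = ringFromℤ commRing

stirling2 : ℕ → ℕ → ℕ
stirling2 zero    zero    = 1
stirling2 zero    (suc k) = 0
stirling2 (suc n) zero    = 0
stirling2 (suc n) (suc k) = suc k ℕ.* stirling2 n (suc k) ℕ.+ stirling2 n k

-- Nondecreasing chains  0 ≤ m₁ ≤ m₂ ≤ ⋯ ≤ m_r ≤ n,  stored as the
-- vector (m₁ , … , m_r).

chains : (r : ℕ) → ℕ → List (Vec ℕ r)
chains zero    n = [] ∷ []
chains (suc r) n = concatMap (λ M → List.map (_∷ʳ M) (chains r M)) (upTo (suc n))

chainsTop : (r : ℕ) → ℕ → List (Vec ℕ (suc r))
chainsTop r M = List.map (_∷ʳ M) (chains r M)

module _ {c ℓ : Level} (K : CharZeroField c ℓ) where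
  open CharZeroField K

  ΣL : {A : Set} → List A → (A → Carrier) → Carrier
  ΣL []       f = 0#
  ΣL (x ∷ xs) f = f x + ΣL xs f

  ΣN : ℕ → (ℕ → Carrier) → Carrier
  ΣN n f = ΣL (upTo (suc n)) f

  ΠV : {n : ℕ} → Vec Carrier n → Carrier
  ΠV []       = 1#
  ΠV (x ∷ xs) = x * ΠV xs

  pow : Carrier → ℕ → Carrier
  pow x zero    = 1#
  pow x (suc n) = x * pow x n

  sgn : ℕ → Carrier
  sgn n = pow (- 1#) n

  zpow : Carrier → ℤ → Carrier
  zpow x (+ n)    = pow x n
  zpow x -[1+ n ] = pow (x ⁻¹) (suc n)

  -- 1 / ((m₁+a-r+1)^{k₁} (m₂+a-r+2)^{k₂} ⋯ (m_r+a)^{k_r})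
  -- (index i : Fin r is 0-based, so the i-th factor uses i+1)
  weight : (r : ℕ) → Vec ℤ r → Carrier → Vec ℕ r → Carrier
  weight r ks a ms =
    ΠV (Vec.tabulate λ (i : Fin r) →
          (zpow (fromℕ (Vec.lookup ms i) + a - fromℕ r + fromℕ (suc (toℕ i)))
                (Vec.lookup ks i)) ⁻¹)

  Series : Set c
  Series = ℕ → Carrier

  _⊛_ : Series → Series → Series
  (f ⊛ g) n = ΣN n (λ i → f i * g (n ∸ i))

  spow : Series → ℕ → Series
  spow g zero    zero    = 1#
  spow g zero    (suc n) = 0#
  spow g (suc m) = g ⊛ spow g m

  -- Composition f(g(t)) for g with zero constant term:
  -- [tⁿ] Σ_M f_M g(t)^M ; since g^M has order ≥ M, only M ≤ n contribute.
  compose : Series → Series → Series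
  compose f g n = ΣN n (λ M → f M * spow g M n)

  -- 1 - e^{-t} = Σ_{j≥1} (-1)^{j+1} t^j / j!
  oneMinusExpNeg : Series
  oneMinusExpNeg zero    = 0#
  oneMinusExpNeg (suc j) = sgn j * (fromℕ (suc j !) ⁻¹)

  -- Hurwitz–Lerch multiple zeta function Φ_{(k₁,…,k_r)}(z,a) as a
  -- formal power series in z (r = suc r'): coefficient of z^M is the
  -- sum over 0 ≤ m₁ ≤ ⋯ ≤ m_r = M.
  Φ : (r' : ℕ) → Vec ℤ (suc r') → Carrier → Series
  Φ r' ks a M = ΣL (chainsTop r' M) (weight (suc r') ks a)

  -- Φ(1 - e^{-t}, a) = Σ_n B_{n,a} tⁿ / n!
  B : (r' : ℕ) → Vec ℤ (suc r') → Carrier → ℕ → Carrier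
  B r' ks a n = fromℕ (n !) * compose (Φ r' ks a) oneMinusExpNeg n

module Submission where

-- Put g(t) = 1 - e^{-t}.  Expanding Φ(z) = Σ_M Φ_M z^M, the definition of B gives
--   B_n = Σ_{M ≤ n} Φ_M · (n! [tⁿ] g(t)^M),
-- so the corollary follows from the classical identity
--   n! [tⁿ] (1 - e^{-t})^M = (-1)^{n+M} M! S(n,M)                                      (★)
-- after merging the sum over M with the sums over the chains whose top entry is M.
--
-- (★) is proved with exponential generating functions.  The EGF ĝ
-- of g satisfies ĝ' = 1 - ĝ, so its powers P_M satisfy P_{M+1}' = (M+1)(P_M - P_{M+1}).
-- The numbers (-1)^{n+M} M! S(n,M) satisfy this triangular recurrence too (it is the Stirling
-- recurrence), with the same boundary values, and the recurrence has a unique solution.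
--
-- The hypothesis on a only ensures that the denominators are non-zero.

open import Defs
open import Level using (Level)
open import Data.Nat as ℕ using (ℕ; suc)
open import Data.Nat.Base using (_!)
open import Data.Integer as ℤ using (ℤ; +_)
open import Data.Vec as Vec using (Vec)
open import Relation.Nullary using (¬_)

open import Data.Nat.Base using (zero; _<_; _≤_)
import Data.Nat.Properties as ℕP
open import Data.Nat.Combinatorics using (_C_; nCk+nC[k+1]≡[n+1]C[k+1]; k>n⇒nCk≡0; k![n∸k]!∣n!)
open import Data.Nat.Combinatorics.Specification using (nCk≡n!/k![n-k]!)
open import Data.Nat.DivMod using (m/n*n≡m)
open import Data.Nat.Tactic.RingSolver using (solve-∀)
open import Data.Fin using (toℕ)
open import Data.Fin.Properties using (toℕ<n; toℕ-inject₁; toℕ-fromℕ)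
open import Data.List as List using (List; []; _∷_; upTo; applyUpTo; concatMap; _++_)
open import Data.Vec.Properties using (last-∷ʳ)
open import Relation.Binary.PropositionalEquality as ≡ using (_≡_; cong; cong₂)

factorial-split : ∀ n i → i ≤ n → n ! ≡ (n C i) ℕ.* (i ! ℕ.* (n ℕ.∸ i) !)
factorial-split n i i≤n =
  ≡.trans (≡.sym (m/n*n≡m (k![n∸k]!∣n! i≤n)))
          (cong (ℕ._* (i ! ℕ.* (n ℕ.∸ i) !)) (≡.sym (nCk≡n!/k![n-k]! i≤n)))
  where instance _ = i ℕP.!≢0
                 _ = (n ℕ.∸ i) ℕP.!≢0
                 _ = ℕP.m*n≢0 (i !) ((n ℕ.∸ i) !)

ordered-stirling-suc : ∀ n M →
  suc M ! ℕ.* stirling2 (suc n) (suc M)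
    ≡ suc M ℕ.* (M ! ℕ.* stirling2 n M ℕ.+ suc M ! ℕ.* stirling2 n (suc M))
ordered-stirling-suc n M = identity (suc M) (M !) (stirling2 n M) (stirling2 n (suc M))
  where
  identity : ∀ m f x y → (m ℕ.* f) ℕ.* (m ℕ.* y ℕ.+ x) ≡ m ℕ.* (f ℕ.* x ℕ.+ (m ℕ.* f) ℕ.* y)
  identity = solve-∀

module Basics {c ℓ : Level} (K : CharZeroField c ℓ) where
  open CharZeroField K hiding (zero)
  open import Algebra.Properties.Semiring.Sum semiring
    using (sum; sum-cong-≋; sum-cong-≗; ∑-distrib-+; *-distribˡ-sum; sum-init-last; sum-replicate-zero)
  open import Algebra.Properties.Semiring.Mult semiring using (_×_; ×-homo-+; ×1-homo-*)
  open import Algebra.Properties.Ring ring using (-0#≈0#; -‿+-comm)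

  fromℕ≡×1 : ∀ n → fromℕ n ≡ n × 1#
  fromℕ≡×1 zero    = ≡.refl
  fromℕ≡×1 (suc n) = cong (_+_ 1#) (fromℕ≡×1 n)

  fromℕ-+ : ∀ m n → fromℕ (m ℕ.+ n) ≈ fromℕ m + fromℕ n
  fromℕ-+ m n rewrite fromℕ≡×1 (m ℕ.+ n) | fromℕ≡×1 m | fromℕ≡×1 n = ×-homo-+ 1# m n

  fromℕ-* : ∀ m n → fromℕ (m ℕ.* n) ≈ fromℕ m * fromℕ n
  fromℕ-* m n rewrite fromℕ≡×1 (m ℕ.* n) | fromℕ≡×1 m | fromℕ≡×1 n = ×1-homo-* m n

  -- It is
  -- opaque, so that the summand can be inferred when one of its lemmas is used; Σ<-suc is
  -- the defining equation.
  opaque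
    Σ< : ℕ → (ℕ → Carrier) → Carrier
    Σ< n f = sum {n} (λ i → f (toℕ i))

    Σ<-suc : ∀ n (f : ℕ → Carrier) → Σ< (suc n) f ≡ f 0 + Σ< n (λ i → f (suc i))
    Σ<-suc n f = ≡.refl

    Σ<-cong : ∀ n {f h : ℕ → Carrier} → (∀ i → i < n → f i ≈ h i) → Σ< n f ≈ Σ< n h
    Σ<-cong n f≈h = sum-cong-≋ {n} (λ i → f≈h (toℕ i) (toℕ<n i))

    Σ<-zero : ∀ n {f : ℕ → Carrier} → (∀ i → i < n → f i ≈ 0#) → Σ< n f ≈ 0#
    Σ<-zero n f≈0 = trans (Σ<-cong n f≈0) (sum-replicate-zero n)

    Σ<-+ : ∀ n {f h : ℕ → Carrier} → Σ< n (λ i → f i + h i) ≈ Σ< n f + Σ< n h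
    Σ<-+ n {f} {h} = ∑-distrib-+ {n} (λ i → f (toℕ i)) (λ i → h (toℕ i))

    Σ<-distribˡ : ∀ n k {f : ℕ → Carrier} → k * Σ< n f ≈ Σ< n (λ i → k * f i)
    Σ<-distribˡ n k {f} = *-distribˡ-sum {n} k (λ i → f (toℕ i))

    Σ<-neg : ∀ n {f : ℕ → Carrier} → - Σ< n f ≈ Σ< n (λ i → - f i)
    Σ<-neg zero    = -0#≈0#
    Σ<-neg (suc n) {f} = trans (sym (-‿+-comm _ _)) (+-congˡ (Σ<-neg n {λ i → f (suc i)}))

    Σ<-snoc : ∀ n {f : ℕ → Carrier} → Σ< (suc n) f ≈ Σ< n f + f n
    Σ<-snoc n {f} = trans (sum-init-last {n} (λ i → f (toℕ i)))
      (reflexive (cong₂ _+_ (sum-cong-≗ {n} (λ i → cong f (toℕ-inject₁ i))) (cong f (toℕ-fromℕ n))))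

    ΣL-applyUpTo : ∀ (s : ℕ → ℕ) n (f : ℕ → Carrier) → ΣL K (applyUpTo s n) f ≡ Σ< n (λ i → f (s i))
    ΣL-applyUpTo s zero    f = ≡.refl
    ΣL-applyUpTo s (suc n) f = cong (_+_ (f (s 0))) (ΣL-applyUpTo (λ i → s (suc i)) n f)

  Σ<-sub : ∀ n {f h : ℕ → Carrier} → Σ< n (λ i → f i - h i) ≈ Σ< n f - Σ< n h
  Σ<-sub n = trans (Σ<-+ n) (+-congˡ (sym (Σ<-neg n)))

  ΣN≡Σ< : ∀ n (f : ℕ → Carrier) → ΣN K n f ≡ Σ< (suc n) f
  ΣN≡Σ< n = ΣL-applyUpTo (λ i → i) (suc n)

  ΣL-cong : ∀ {A : Set} (xs : List A) {f h : A → Carrier} → (∀ x → f x ≈ h x) → ΣL K xs f ≈ ΣL K xs h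
  ΣL-cong []       f≈h = refl
  ΣL-cong (x ∷ xs) f≈h = +-cong (f≈h x) (ΣL-cong xs f≈h)

  ΣL-distribˡ : ∀ {A : Set} (xs : List A) k (f : A → Carrier) → k * ΣL K xs f ≈ ΣL K xs (λ x → k * f x)
  ΣL-distribˡ []       k f = zeroʳ k
  ΣL-distribˡ (x ∷ xs) k f = trans (distribˡ k _ _) (+-congˡ (ΣL-distribˡ xs k f))

  ΣL-map : ∀ {A B : Set} (h : A → B) (xs : List A) (f : B → Carrier) →
           ΣL K (List.map h xs) f ≡ ΣL K xs (λ x → f (h x))
  ΣL-map h []       f = ≡.refl
  ΣL-map h (x ∷ xs) f = cong (_+_ (f (h x))) (ΣL-map h xs f)

  ΣL-++ : ∀ {A : Set} (xs ys : List A) (f : A → Carrier) → ΣL K (xs ++ ys) f ≈ ΣL K xs f + ΣL K ys f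
  ΣL-++ []       ys f = sym (+-identityˡ _)
  ΣL-++ (x ∷ xs) ys f = trans (+-congˡ (ΣL-++ xs ys f)) (sym (+-assoc _ _ _))

  ΣL-concatMap : ∀ {A B : Set} (h : A → List B) (xs : List A) (f : B → Carrier) →
                 ΣL K (concatMap h xs) f ≈ ΣL K xs (λ x → ΣL K (h x) f)
  ΣL-concatMap h []       f = refl
  ΣL-concatMap h (x ∷ xs) f = trans (ΣL-++ (h x) (concatMap h xs) f) (+-congˡ (ΣL-concatMap h xs f))

-- Exponential generating functions, represented by their coefficient sequences (Series K):
-- the sequence a stands for Σ aₙ tⁿ/n!.
module ExponentialSeries {c ℓ : Level} (K : CharZeroField c ℓ) where
  open CharZeroField K hiding (zero)
  open Basics K
  open import Algebra.Properties.Ring ring using (x[y-z]≈xy-xz; [y-z]x≈yx-zx)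
  open import Algebra.Properties.CommutativeSemigroup *-commutativeSemigroup using (interchange; x∙yz≈y∙xz)
  open import Algebra.Properties.CommutativeSemigroup +-commutativeSemigroup using ()
    renaming (x∙yz≈y∙xz to x+[y+z]≈y+[x+z])
  open import Relation.Binary.Reasoning.Setoid setoid

  egf : Series K → Series K
  egf f n = fromℕ (n !) * f n

  -- derivative of an EGF: shift the coefficients
  D : Series K → Series K
  D a n = a (suc n)

  δ : Series K
  δ zero    = 1#
  δ (suc n) = 0#

  -- binomial convolution: the coefficients of the product of two EGFs
  -- (opaque: below it is only used through the lemmas that follow)
  opaque
    infixl 7 _⋆_
    _⋆_ : Series K → Series K → Series K
    (a ⋆ b) n = Σ< (suc n) (λ i → fromℕ (n C i) * (a i * b (n ℕ.∸ i)))

    ⋆-cong : ∀ {a a′ b b′ : Series K} → (∀ i → a i ≈ a′ i) → (∀ i → b i ≈ b′ i) →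
             ∀ n → (a ⋆ b) n ≈ (a′ ⋆ b′) n
    ⋆-cong a≈a′ b≈b′ n = Σ<-cong (suc n) (λ i _ → *-congˡ (*-cong (a≈a′ i) (b≈b′ (n ℕ.∸ i))))

    ⋆-subˡ : ∀ (a a′ b : Series K) n → ((λ i → a i - a′ i) ⋆ b) n ≈ (a ⋆ b) n - (a′ ⋆ b) n
    ⋆-subˡ a a′ b n = trans
      (Σ<-cong (suc n) (λ i _ → trans (*-congˡ ([y-z]x≈yx-zx _ _ _)) (x[y-z]≈xy-xz _ _ _)))
      (Σ<-sub (suc n))

    ⋆-subʳ : ∀ (a b b′ : Series K) n → (a ⋆ (λ i → b i - b′ i)) n ≈ (a ⋆ b) n - (a ⋆ b′) n
    ⋆-subʳ a b b′ n = trans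
      (Σ<-cong (suc n) (λ i _ → trans (*-congˡ (x[y-z]≈xy-xz _ _ _)) (x[y-z]≈xy-xz _ _ _)))
      (Σ<-sub (suc n))

    ⋆-scaleʳ : ∀ (a b : Series K) k n → (a ⋆ (λ i → k * b i)) n ≈ k * (a ⋆ b) n
    ⋆-scaleʳ a b k n = trans
      (Σ<-cong (suc n) (λ i _ → trans (*-congˡ (x∙yz≈y∙xz _ _ _)) (x∙yz≈y∙xz _ _ _)))
      (sym (Σ<-distribˡ (suc n) k))

    ⋆-zeroʳ : ∀ (a b : Series K) → (∀ i → b i ≈ 0#) → ∀ n → (a ⋆ b) n ≈ 0#
    ⋆-zeroʳ a b b≈0 n = Σ<-zero (suc n)
      (λ i _ → trans (*-congˡ (trans (*-congˡ (b≈0 (n ℕ.∸ i))) (zeroʳ _))) (zeroʳ _))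

    δ-⋆ : ∀ (b : Series K) n → (δ ⋆ b) n ≈ b n
    δ-⋆ b n = begin
      (δ ⋆ b) n
        ≡⟨ Σ<-suc n _ ⟩
      fromℕ 1 * (1# * b n) + Σ< n (λ i → fromℕ (n C suc i) * (0# * b (n ℕ.∸ suc i)))
        ≈⟨ +-congˡ (Σ<-zero n (λ i _ → trans (*-congˡ (zeroˡ _)) (zeroʳ _))) ⟩
      fromℕ 1 * (1# * b n) + 0#
        ≈⟨ trans (+-identityʳ _) (*-congʳ (+-identityʳ 1#)) ⟩
      1# * (1# * b n)
        ≈⟨ trans (*-identityˡ _) (*-identityˡ _) ⟩
      b n ∎

    -- Leibniz rule (ab)' = a'b + ab'; coefficientwise it is Pascal's rule
    leibniz : ∀ (a b : Series K) n → (a ⋆ b) (suc n) ≈ (D a ⋆ b) n + (a ⋆ D b) n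
    leibniz a b n = begin
      (a ⋆ b) (suc n)
        ≡⟨ Σ<-suc (suc n) _ ⟩
      lead + Σ< (suc n) (λ i → fromℕ (suc n C suc i) * T i)
        ≈⟨ +-congˡ (trans (Σ<-cong (suc n) (λ i _ → pascal i)) (Σ<-+ (suc n))) ⟩
      lead + ((D a ⋆ b) n + Σ< (suc n) (λ i → fromℕ (n C suc i) * T i))
        ≈⟨ +-congˡ (+-congˡ upper) ⟩
      lead + ((D a ⋆ b) n + Σ< n (λ i → fromℕ (n C suc i) * (a (suc i) * D b (n ℕ.∸ suc i))))
        ≈⟨ x+[y+z]≈y+[x+z] _ _ _ ⟩
      (D a ⋆ b) n + (lead + Σ< n (λ i → fromℕ (n C suc i) * (a (suc i) * D b (n ℕ.∸ suc i))))
        ≡⟨ cong (_+_ ((D a ⋆ b) n)) (≡.sym (Σ<-suc n _)) ⟩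
      (D a ⋆ b) n + (a ⋆ D b) n ∎
      where
      T : ℕ → Carrier
      T i = a (suc i) * b (n ℕ.∸ i)

      lead : Carrier
      lead = fromℕ (suc n C 0) * (a 0 * b (suc n))

      pascal : ∀ i → fromℕ (suc n C suc i) * T i ≈ fromℕ (n C i) * T i + fromℕ (n C suc i) * T i
      pascal i = trans (*-congʳ (trans (reflexive (cong fromℕ (≡.sym (nCk+nC[k+1]≡[n+1]C[k+1] n i))))
                                       (fromℕ-+ (n C i) (n C suc i))))
                       (distribʳ _ _ _)

      -- the top term has C(n,n+1) = 0; the remaining ones are the tail of (a ⋆ D b) n
      upper : Σ< (suc n) (λ i → fromℕ (n C suc i) * T i)
            ≈ Σ< n (λ i → fromℕ (n C suc i) * (a (suc i) * D b (n ℕ.∸ suc i)))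
      upper = begin
        Σ< (suc n) (λ i → fromℕ (n C suc i) * T i)
          ≈⟨ Σ<-snoc n ⟩
        Σ< n (λ i → fromℕ (n C suc i) * T i) + fromℕ (n C suc n) * T n
          ≈⟨ +-congˡ (trans (*-congʳ (reflexive (cong fromℕ (k>n⇒nCk≡0 (ℕP.n<1+n n))))) (zeroˡ _)) ⟩
        Σ< n (λ i → fromℕ (n C suc i) * T i) + 0#
          ≈⟨ +-identityʳ _ ⟩
        Σ< n (λ i → fromℕ (n C suc i) * T i)
          ≈⟨ Σ<-cong n (λ i i<n → reflexive (cong (λ m → fromℕ (n C suc i) * (a (suc i) * b m))
                                                (ℕP.+-∸-assoc 1 i<n))) ⟩
        Σ< n (λ i → fromℕ (n C suc i) * (a (suc i) * D b (n ℕ.∸ suc i))) ∎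

    egf-⊛ : ∀ (f h : Series K) n → egf (_⊛_ K f h) n ≈ (egf f ⋆ egf h) n
    egf-⊛ f h n = begin
      fromℕ (n !) * ΣN K n (λ i → f i * h (n ℕ.∸ i))
        ≡⟨ cong (fromℕ (n !) *_) (ΣN≡Σ< n _) ⟩
      fromℕ (n !) * Σ< (suc n) (λ i → f i * h (n ℕ.∸ i))
        ≈⟨ Σ<-distribˡ (suc n) _ ⟩
      Σ< (suc n) (λ i → fromℕ (n !) * (f i * h (n ℕ.∸ i)))
        ≈⟨ Σ<-cong (suc n) (λ i i<1+n → term i (ℕP.≤-pred i<1+n)) ⟩
      (egf f ⋆ egf h) n ∎
      where
      term : ∀ i → i ≤ n →
             fromℕ (n !) * (f i * h (n ℕ.∸ i)) ≈ fromℕ (n C i) * (egf f i * egf h (n ℕ.∸ i))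
      term i i≤n = begin
        fromℕ (n !) * (f i * h (n ℕ.∸ i))
          ≡⟨ cong (λ m → fromℕ m * (f i * h (n ℕ.∸ i))) (factorial-split n i i≤n) ⟩
        fromℕ ((n C i) ℕ.* (i ! ℕ.* (n ℕ.∸ i) !)) * (f i * h (n ℕ.∸ i))
          ≈⟨ *-congʳ (trans (fromℕ-* (n C i) _) (*-congˡ (fromℕ-* (i !) ((n ℕ.∸ i) !)))) ⟩
        (fromℕ (n C i) * (fromℕ (i !) * fromℕ ((n ℕ.∸ i) !))) * (f i * h (n ℕ.∸ i))
          ≈⟨ trans (*-assoc _ _ _) (*-congˡ (interchange _ _ _ _)) ⟩
        fromℕ (n C i) * (egf f i * egf h (n ℕ.∸ i)) ∎

  -- Let u satisfy u' = 1 - u, and let Q be its sequence of ⋆-powers.  Then the chain rule for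
  -- the powers reads  Q_{M+1}' = (M+1) Q_M ⋆ u' = (M+1)(Q_M - Q_{M+1}).
  module PowerDerivative (u : Series K) (Q : ℕ → Series K)
                         (u′ : ∀ i → D u i ≈ δ i - u i)
                         (Q-zero : ∀ n → Q 0 n ≈ δ n)
                         (Q-suc : ∀ M n → Q (suc M) n ≈ (u ⋆ Q M) n) where

    u′⋆Q : ∀ M n → (D u ⋆ Q M) n ≈ Q M n - Q (suc M) n
    u′⋆Q M n = begin
      (D u ⋆ Q M) n                 ≈⟨ ⋆-cong u′ (λ _ → refl) n ⟩
      ((λ i → δ i - u i) ⋆ Q M) n   ≈⟨ ⋆-subˡ δ u (Q M) n ⟩
      (δ ⋆ Q M) n - (u ⋆ Q M) n     ≈⟨ +-cong (δ-⋆ (Q M) n) (-‿cong (sym (Q-suc M n))) ⟩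
      Q M n - Q (suc M) n           ∎

    power-derivative-step : ∀ M n → (u ⋆ D (Q M)) n ≈ fromℕ M * (Q M n - Q (suc M) n) →
                            D (Q (suc M)) n ≈ fromℕ (suc M) * (Q M n - Q (suc M) n)
    power-derivative-step M n u⋆Q′ = begin
      Q (suc M) (suc n)                                     ≈⟨ Q-suc M (suc n) ⟩
      (u ⋆ Q M) (suc n)                                     ≈⟨ leibniz u (Q M) n ⟩
      (D u ⋆ Q M) n + (u ⋆ D (Q M)) n                       ≈⟨ +-cong (u′⋆Q M n) u⋆Q′ ⟩
      (Q M n - Q (suc M) n) + fromℕ M * (Q M n - Q (suc M) n)
        ≈⟨ sym (trans (distribʳ _ _ _) (+-congʳ (*-identityˡ _))) ⟩
      fromℕ (suc M) * (Q M n - Q (suc M) n)                 ∎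

    -- induction on M: Q₀ = δ is constant, and for M+1 the derivative of Q_{M+1} is the claim for M
    power-derivative : ∀ M n → D (Q (suc M)) n ≈ fromℕ (suc M) * (Q M n - Q (suc M) n)
    power-derivative zero n =
      power-derivative-step zero n (trans (⋆-zeroʳ u _ (λ i → Q-zero (suc i)) n) (sym (zeroˡ _)))
    power-derivative (suc M) n = power-derivative-step (suc M) n (begin
      (u ⋆ D (Q (suc M))) n
        ≈⟨ ⋆-cong (λ _ → refl) (power-derivative M) n ⟩
      (u ⋆ (λ i → fromℕ (suc M) * (Q M i - Q (suc M) i))) n
        ≈⟨ ⋆-scaleʳ u _ (fromℕ (suc M)) n ⟩
      fromℕ (suc M) * (u ⋆ (λ i → Q M i - Q (suc M) i)) n
        ≈⟨ *-congˡ (⋆-subʳ u (Q M) (Q (suc M)) n) ⟩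
      fromℕ (suc M) * ((u ⋆ Q M) n - (u ⋆ Q (suc M)) n)
        ≈⟨ *-congˡ (+-cong (sym (Q-suc M n)) (-‿cong (sym (Q-suc (suc M) n)))) ⟩
      fromℕ (suc M) * (Q (suc M) n - Q (suc (suc M)) n) ∎)

  record SolvesRecurrence (X : ℕ → Series K) : Set ℓ where
    field
      column-zero : ∀ n → X 0 n ≈ δ n
      row-zero    : ∀ M → X (suc M) 0 ≈ 0#
      recurrence  : ∀ M n → X (suc M) (suc n) ≈ fromℕ (suc M) * (X M n - X (suc M) n)

  recurrence-unique : ∀ {X Y} → SolvesRecurrence X → SolvesRecurrence Y → ∀ M n → X M n ≈ Y M n
  recurrence-unique {X} {Y} solX solY = unique
    where
    module SX = SolvesRecurrence solX
    module SY = SolvesRecurrence solY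
    unique : ∀ M n → X M n ≈ Y M n
    unique zero    n       = trans (SX.column-zero n) (sym (SY.column-zero n))
    unique (suc M) zero    = trans (SX.row-zero M) (sym (SY.row-zero M))
    unique (suc M) (suc n) = begin
      X (suc M) (suc n)                      ≈⟨ SX.recurrence M n ⟩
      fromℕ (suc M) * (X M n - X (suc M) n)  ≈⟨ *-congˡ (+-cong (unique M n) (-‿cong (unique (suc M) n))) ⟩
      fromℕ (suc M) * (Y M n - Y (suc M) n)  ≈⟨ sym (SY.recurrence M n) ⟩
      Y (suc M) (suc n)                      ∎

module OneMinusExp {c ℓ : Level} (K : CharZeroField c ℓ) where
  open CharZeroField K hiding (zero)
  open Basics K
  open ExponentialSeries K
  open import Algebra.Properties.Ring ring using (-0#≈0#; -1*x≈-x; -‿involutive; -‿distribˡ-*)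
  open import Algebra.Properties.CommutativeSemigroup *-commutativeSemigroup using (x∙yz≈y∙xz)
  open import Relation.Binary.Reasoning.Setoid setoid

  g : Series K
  g = oneMinusExpNeg K

  ĝ : Series K
  ĝ = egf g

  fromℕ-inverse : ∀ m → 0 < m → fromℕ m * fromℕ m ⁻¹ ≈ 1#
  fromℕ-inverse (suc m) _ = inverseʳ _ (charZero m)

  sgn-suc : ∀ k → sgn K (suc k) ≈ - sgn K k
  sgn-suc k = -1*x≈-x (sgn K k)

  ĝ-suc : ∀ j → ĝ (suc j) ≈ sgn K j
  ĝ-suc j = begin
    fromℕ (suc j !) * (sgn K j * fromℕ (suc j !) ⁻¹)  ≈⟨ x∙yz≈y∙xz _ _ _ ⟩
    sgn K j * (fromℕ (suc j !) * fromℕ (suc j !) ⁻¹)  ≈⟨ *-congˡ (fromℕ-inverse (suc j !) (ℕP.1≤n! (suc j))) ⟩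
    sgn K j * 1#                                      ≈⟨ *-identityʳ _ ⟩
    sgn K j                                           ∎

  ĝ-derivative : ∀ i → D ĝ i ≈ δ i - ĝ i
  ĝ-derivative zero = begin
    ĝ 1           ≈⟨ ĝ-suc 0 ⟩
    1#            ≈⟨ sym (+-identityʳ 1#) ⟩
    1# + 0#       ≈⟨ +-congˡ (trans (sym -0#≈0#) (-‿cong (sym (zeroʳ _)))) ⟩
    1# - ĝ 0      ∎
  ĝ-derivative (suc j) = begin
    ĝ (suc (suc j))  ≈⟨ ĝ-suc (suc j) ⟩
    sgn K (suc j)    ≈⟨ sgn-suc j ⟩
    - sgn K j        ≈⟨ -‿cong (sym (ĝ-suc j)) ⟩
    - ĝ (suc j)      ≈⟨ sym (+-identityˡ _) ⟩
    0# - ĝ (suc j)   ∎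

  P : ℕ → Series K
  P M = egf (spow K g M)

  P-zero : ∀ n → P 0 n ≈ δ n
  P-zero zero    = trans (*-identityʳ _) (+-identityʳ _)
  P-zero (suc n) = zeroʳ _

  P-suc : ∀ M n → P (suc M) n ≈ (ĝ ⋆ P M) n
  P-suc M = egf-⊛ g (spow K g M)

  P-solves : SolvesRecurrence P
  P-solves = record
    { column-zero = P-zero
    ; row-zero    = λ M → trans (*-congˡ (trans (+-identityʳ _) (zeroˡ _))) (zeroʳ _)
    ; recurrence  = PowerDerivative.power-derivative ĝ P ĝ-derivative P-zero P-suc
    }

  signedStirling : ℕ → Series K
  signedStirling M n = sgn K (n ℕ.+ M) * fromℕ (M ! ℕ.* stirling2 n M)

  signedStirling-step : ∀ M n → signedStirling (suc M) (suc n)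
                              ≈ fromℕ (suc M) * (signedStirling M n - signedStirling (suc M) n)
  signedStirling-step M n = begin
    sgn K (suc n ℕ.+ suc M) * fromℕ (suc M ! ℕ.* stirling2 (suc n) (suc M))
      ≈⟨ *-cong sign-shift (reflexive (cong fromℕ (ordered-stirling-suc n M))) ⟩
    s * fromℕ (suc M ℕ.* (x ℕ.+ y))
      ≈⟨ *-congˡ (trans (fromℕ-* (suc M) (x ℕ.+ y)) (*-congˡ (fromℕ-+ x y))) ⟩
    s * (m * (fromℕ x + fromℕ y))
      ≈⟨ x∙yz≈y∙xz s m _ ⟩
    m * (s * (fromℕ x + fromℕ y))
      ≈⟨ *-congˡ (distribˡ s (fromℕ x) (fromℕ y)) ⟩
    m * (s * fromℕ x + s * fromℕ y)
      ≈⟨ *-congˡ (+-congˡ (sym negated-next)) ⟩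
    m * (signedStirling M n - signedStirling (suc M) n) ∎
    where
    s = sgn K (n ℕ.+ M)
    m = fromℕ (suc M)
    x = M ! ℕ.* stirling2 n M
    y = suc M ! ℕ.* stirling2 n (suc M)

    sign-next : sgn K (n ℕ.+ suc M) ≈ - s
    sign-next = trans (reflexive (cong (sgn K) (ℕP.+-suc n M))) (sgn-suc (n ℕ.+ M))

    sign-shift : sgn K (suc n ℕ.+ suc M) ≈ s
    sign-shift = trans (sgn-suc (n ℕ.+ suc M)) (trans (-‿cong sign-next) (-‿involutive s))

    negated-next : - (sgn K (n ℕ.+ suc M) * fromℕ y) ≈ s * fromℕ y
    negated-next = trans (-‿cong (*-congʳ sign-next)) (trans (-‿distribˡ-* (- s) _) (*-congʳ (-‿involutive s)))

  signedStirling-solves : SolvesRecurrence signedStirling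
  signedStirling-solves = record
    { column-zero = column-zero
    ; row-zero    = λ M → trans (*-congˡ (reflexive (cong fromℕ (ℕP.*-zeroʳ (suc M !))))) (zeroʳ _)
    ; recurrence  = signedStirling-step
    }
    where
    column-zero : ∀ n → signedStirling 0 n ≈ δ n
    column-zero zero    = trans (*-identityˡ _) (+-identityʳ _)
    column-zero (suc n) = zeroʳ _

  powers-of-one-minus-exp : ∀ M n → fromℕ (n !) * spow K g M n ≈ signedStirling M n
  powers-of-one-minus-exp = recurrence-unique P-solves signedStirling-solves

-- Corollary 3.1.  B_n = n! Σ_{M ≤ n} Φ_M [tⁿ] g(t)^M; by (★) the M-th term is the sum over
-- the chains with top entry M of (-1)^{n+M} M! S(n,M) times their weight, and these chains
-- together are all chains 0 ≤ m₁ ≤ ⋯ ≤ m_r ≤ n.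
corollary3p1 : {c ℓ : Level} (K : CharZeroField c ℓ) (r' : ℕ) (ks : Vec ℤ (suc r'))
    (a : CharZeroField.Carrier K)
    → (∀ (j : ℤ) → j ℤ.≤ + r' → ¬ (CharZeroField._≈_ K a (CharZeroField.fromℤ K j)))
    → (n : ℕ)
    → CharZeroField._≈_ K (B K r' ks a n)
        (ΣL K (chains (suc r') n) (λ ms →
          CharZeroField._*_ K
            (CharZeroField._*_ K (sgn K (n ℕ.+ Vec.last ms))
              (CharZeroField.fromℕ K (Vec.last ms ! ℕ.* stirling2 n (Vec.last ms))))
            (weight K (suc r') ks a ms)))
corollary3p1 K r' ks a _ n = begin
    fromℕ (n !) * ΣL K (upTo (suc n)) (λ M → Φ K r' ks a M * spow K g M n)
      ≈⟨ ΣL-distribˡ (upTo (suc n)) (fromℕ (n !)) _ ⟩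
    ΣL K (upTo (suc n)) (λ M → fromℕ (n !) * (Φ K r' ks a M * spow K g M n))
      ≈⟨ ΣL-cong (upTo (suc n)) column ⟩
    ΣL K (upTo (suc n)) (λ M → ΣL K (chainsTop r' M) summand)
      ≈⟨ sym (ΣL-concatMap (chainsTop r') (upTo (suc n)) summand) ⟩
    ΣL K (chains (suc r') n) summand ∎
  where
  open CharZeroField K hiding (zero)
  open Basics K
  open OneMinusExp K using (g; signedStirling; powers-of-one-minus-exp)
  open import Algebra.Properties.CommutativeSemigroup *-commutativeSemigroup using (x∙yz≈y∙xz)
  open import Relation.Binary.Reasoning.Setoid setoid

  w : Vec ℕ (suc r') → Carrier
  w = weight K (suc r') ks a

  summand : Vec ℕ (suc r') → Carrier
  summand ms = signedStirling (Vec.last ms) n * w ms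

  column : ∀ M → fromℕ (n !) * (Φ K r' ks a M * spow K g M n) ≈ ΣL K (chainsTop r' M) summand
  column M = begin
    fromℕ (n !) * (Φ K r' ks a M * spow K g M n)
      ≈⟨ x∙yz≈y∙xz _ _ _ ⟩
    Φ K r' ks a M * (fromℕ (n !) * spow K g M n)
      ≈⟨ trans (*-congˡ (powers-of-one-minus-exp M n)) (*-comm _ _) ⟩
    signedStirling M n * ΣL K (List.map (Vec._∷ʳ M) (chains r' M)) w
      ≡⟨ cong (signedStirling M n *_) (ΣL-map (Vec._∷ʳ M) (chains r' M) w) ⟩
    signedStirling M n * ΣL K (chains r' M) (λ ms → w (ms Vec.∷ʳ M))
      ≈⟨ ΣL-distribˡ (chains r' M) _ _ ⟩
    ΣL K (chains r' M) (λ ms → signedStirling M n * w (ms Vec.∷ʳ M))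
      ≈⟨ ΣL-cong (chains r' M) (λ ms → reflexive (cong (λ z → signedStirling z n * w (ms Vec.∷ʳ M))
                                                        (≡.sym (last-∷ʳ M ms)))) ⟩
    ΣL K (chains r' M) (λ ms → summand (ms Vec.∷ʳ M))
      ≡⟨ ≡.sym (ΣL-map (Vec._∷ʳ M) (chains r' M) summand) ⟩
    ΣL K (chainsTop r' M) summand ∎
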